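{- Let $T$ be an irreducible, minimum-cost two-way-comparison decision tree for an instance $(Q,w,\mathcal C,K)$. Let $u_1\to u_2\to\cdots\to u_d$ be any downward path in $T$ (not necessarily starting at the root), and let $u_2'$ denote the sibling of $u_2$. Suppose $w(u_2')<w(u_d)$. Then for all distinct indices $i,j$ with $i,j<d$, both outcomes at $u_i$ are consistent with the outcome $u_j\to u_{j+1}$.
   Context: An instance $(Q,w,\mathcal C,K)$ consists of a totally ordered finite set $Q$ of queries, each with a weight $w(q)\ge 0$; a collection $\mathcal C\subseteq 2^Q$ of classes; and a set $K\subseteq Q$ of keys; every query belongs to some class. An allowed test is "$q<k$" for some $k\in K$ with $\min Q<k\le\max Q$, or "$q=k$" for some $k\in K$. A two-way-comparison decision tree is a rooted binary tree whose non-leaf nodes are allowed tests, with children labeled by the outcomes yes/no, and whose leaves are labeled by classes in $\mathcal C$, each leaf's class containing every query whose search ends there. The search for $q$ starts at the root and moves to the yes-child if $q$ satisfies the test and to the no-child otherwise; $q$ reaches every node on its search path; its depth is the number of tests on the path; the cost of the tree is $\sum_q w(q)\,\mathrm{depth}(q)$. The query set $Q_u$ of a node $u$ is the set of queries reaching $u$, and $w(u)=\sum_{q\in Q_u}w(q)$. The tree is irreducible if for every node $u$, (i) at least one query reaches $u$, and (ii) if some class contains all of $Q_u$ then $u$ is a leaf. Each edge $u\to v$ from a test node to a child is identified with the corresponding outcome of the test at $u$. Two outcomes (of tests, possibly at different nodes) are consistent if some query in $Q$ satisfies both, and inconsistent otherwise.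
   Formalization: The query weights $w(q)$ are nonnegative rationals. -}

module Defs where

open import Data.Nat as ℕ using (ℕ; zero; suc)
open import Data.Bool using (Bool; true; false; not; if_then_else_)
open import Data.Fin using (Fin; toℕ; _<_; _<?_; _≟_)
open import Data.Fin.Subset using (Subset) renaming (_∈_ to _∈ₛ_)
open import Data.List using (List; []; _∷_; foldr; map)
open import Data.List.Membership.Propositional using () renaming (_∈_ to _∈ₗ_)
open import Data.Vec.Functional using () renaming (foldr to foldrᵥ)
open import Data.Maybe using (Maybe; just; nothing)
open import Data.Product using (Σ; ∃; _×_; _,_)
open import Data.Unit using (⊤)
open import Data.Empty using (⊥)
open import Data.Integer using (+_)
open import Data.Rational using (ℚ; 0ℚ; _+_; _*_; _/_) renaming (_≤_ to _≤ℚ_)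
open import Relation.Nullary using (does)
open import Relation.Binary.PropositionalEquality using (_≡_)

-- Instances (Q, w, 𝒞, K).  Q is the totally ordered finite set Fin n
-- (with its natural order); weights are nonnegative rationals.

record Instance : Set where
  field
    n       : ℕ
    w       : Fin n → ℚ
    w≥0     : ∀ q → 0ℚ ≤ℚ w q
    classes : List (Subset n)
    keys    : Subset n
    covered : ∀ (q : Fin n) → ∃ λ C → C ∈ₗ classes × q ∈ₛ C

data Test (n : ℕ) : Set where
  lt  : Fin n → Test n
  eqt : Fin n → Test n

sat : ∀ {n} → Test n → Fin n → Bool
sat (lt k)  q = does (q <? k)
sat (eqt k) q = does (q ≟ k)

-- binary trees: node t yes-child no-child; leaves labelled by a set of queries (a class)
data Tree (n : ℕ) : Set where
  leaf : Subset n → Tree n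
  node : Test n → Tree n → Tree n → Tree n

IsLeaf : ∀ {n} → Tree n → Set
IsLeaf (leaf _)     = ⊤
IsLeaf (node _ _ _) = ⊥

-- Nodes are addressed by the list of outcomes from the root (true = yes).
Address : Set
Address = List Bool

subtree : ∀ {n} → Tree n → Address → Maybe (Tree n)
subtree T [] = just T
subtree (leaf _) (_ ∷ _) = nothing
subtree (node t y z) (true ∷ a) = subtree y a
subtree (node t y z) (false ∷ a) = subtree z a

testAt : ∀ {n} → Tree n → Address → Maybe (Test n)
testAt T a with subtree T a
... | just (node t _ _) = just t
... | just (leaf _)     = nothing
... | nothing           = nothing

reaches : ∀ {n} → Tree n → Fin n → Address → Bool
reaches T q [] = true
reaches (leaf _) q (_ ∷ _) = false
reaches (node t y z) q (true ∷ a)  = if sat t q then reaches y q a else false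
reaches (node t y z) q (false ∷ a) = if sat t q then false else reaches z q a

depth : ∀ {n} → Tree n → Fin n → ℕ
depth (leaf _) q = zero
depth (node t y z) q = suc (if sat t q then depth y q else depth z q)

Σℚ : ∀ {n} → (Fin n → ℚ) → ℚ
Σℚ f = foldrᵥ _+_ 0ℚ f

ℕ→ℚ : ℕ → ℚ
ℕ→ℚ d = (+ d) / 1

module _ (I : Instance) where
  open Instance I

  weight : Tree n → Address → ℚ
  weight T a = Σℚ (λ q → if reaches T q a then w q else 0ℚ)

  cost : Tree n → ℚ
  cost T = Σℚ (λ q → w q * ℕ→ℚ (depth T q))

  -- allowed tests: "q < k" with k ∈ K and min Q < k ≤ max Q; "q = k" with k ∈ K
  Allowed : Test n → Set
  Allowed (lt k)  = k ∈ₛ keys × 0 ℕ.< toℕ k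
  Allowed (eqt k) = k ∈ₛ keys

  IsDecisionTree : Tree n → Set
  IsDecisionTree T =
    (∀ a t y z → subtree T a ≡ just (node t y z) → Allowed t) ×
    (∀ a C → subtree T a ≡ just (leaf C) →
       C ∈ₗ classes × (∀ q → reaches T q a ≡ true → q ∈ₛ C))

  Irreducible : Tree n → Set
  Irreducible T = ∀ a u → subtree T a ≡ just u →
    (∃ λ q → reaches T q a ≡ true) ×
    (∀ C → C ∈ₗ classes → (∀ q → reaches T q a ≡ true → q ∈ₛ C) → IsLeaf u)

  MinimumCost : Tree n → Set
  MinimumCost T = IsDecisionTree T × (∀ T′ → IsDecisionTree T′ → cost T ≤ℚ cost T′)

  Consistent : Test n × Bool → Test n × Bool → Set
  Consistent (t₁ , b₁) (t₂ , b₂) = ∃ λ q → sat t₁ q ≡ b₁ × sat t₂ q ≡ b₂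

{-# OPTIONS --safe #-}
-- Suppose the outcome of u_j on the path is inconsistent with the outcome c at u_i. If u_i lies
-- below u_j, or above it with c the outcome taken by the path, any query reaching the relevant
-- child (one exists by irreducibility) witnesses consistency. Otherwise the path outcome at u_j
-- forces the path outcome at its ancestor u_i, and an exchange argument gives
-- w(u_d) ≤ w(u_{j+1}) ≤ w(u₂′), a contradiction.
--
-- The exchange: if an outcome (t, c) below u₁ forces the outcome taken at u₁, move t to the root
-- of the subtree at u₁ and prune the tests that become constant in the two copies below it.
-- Queries of u₂′ pay one more test, all others save at least one, and those reaching the c-child
-- of t save two; minimality of T then gives w(c-child of t) ≤ w(u₂′). A forced ancestor further
-- down the path is reduced to this case one edge at a time, using that for comparison tests, if
-- both outcomes of t meet an outcome o, one of them forces o.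
module Submission where

open import Defs
open import Data.Bool using (Bool; not)
open import Data.Fin using (Fin; toℕ)
open import Data.List using (List; _∷_; []; _++_; take; length; lookup)
open import Data.Maybe using (just)
open import Data.Product using (_×_; _,_)
open import Data.Rational using () renaming (_<_ to _<ℚ_)
open import Relation.Binary.PropositionalEquality using (_≡_; _≢_)

open import Algebra.Bundles using (CommutativeMonoid)
open import Data.Bool using (true; false; _∧_; if_then_else_)
open import Data.Bool.Properties
  using (∧-assoc; ∧-conicalˡ; ∧-conicalʳ; not-involutive; not-¬; ¬-not) renaming (_≟_ to _≟ᵇ_)
open import Data.Empty using (⊥-elim)
open import Data.Fin using (zero; suc; _<?_; _≟_)
open import Data.Fin.Properties using (any?; toℕ-injective)
open import Data.Fin.Subset using () renaming (_∈_ to _∈ₛ_)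
import Data.Integer as ℤ
import Data.Integer.Properties as ℤ
open import Data.List.Membership.Propositional using () renaming (_∈_ to _∈ₗ_)
open import Data.List.Properties using (++-assoc; ++-identityʳ; ∷ʳ-++; ∷-injectiveˡ; ∷-injectiveʳ; ++-conicalʳ)
open import Data.Nat as ℕ using (ℕ; zero; suc; z≤n; s≤s)
import Data.Nat.Properties as ℕ
open import Data.Product using (∃; ∃₂; proj₁; proj₂)
open import Data.Rational using (ℚ; 0ℚ; _+_; _*_; -_; toℚᵘ; nonNegative) renaming (_≤_ to _≤ℚ_)
import Data.Rational.Properties as ℚ
import Data.Rational.Unnormalised as ℚᵘ
import Data.Rational.Unnormalised.Properties as ℚᵘ
open import Data.Sum using (_⊎_; inj₁; inj₂; swap)
open import Function using (_∘_)
open import Relation.Binary.Definitions using (tri<; tri≈; tri>)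
open import Relation.Binary.PropositionalEquality using (_≗_; refl; sym; trans; cong; cong₂; subst; subst₂)
open import Relation.Nullary using (¬_; Dec; yes; no; does)
open import Relation.Nullary.Decidable using (_×-dec_; dec-true; dec-false)
open import Algebra.Properties.CommutativeSemigroup
  (CommutativeMonoid.commutativeSemigroup ℚ.+-0-commutativeMonoid) using (interchange)

Σℚ-cong : ∀ {n} {f g : Fin n → ℚ} → (∀ q → f q ≡ g q) → Σℚ f ≡ Σℚ g
Σℚ-cong {zero}  _   = refl
Σℚ-cong {suc n} f≗g = cong₂ _+_ (f≗g zero) (Σℚ-cong (f≗g ∘ suc))

Σℚ-mono-≤ : ∀ {n} {f g : Fin n → ℚ} → (∀ q → f q ≤ℚ g q) → Σℚ f ≤ℚ Σℚ g
Σℚ-mono-≤ {zero}  _   = ℚ.≤-refl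
Σℚ-mono-≤ {suc n} f≤g = ℚ.+-mono-≤ (f≤g zero) (Σℚ-mono-≤ (f≤g ∘ suc))

Σℚ-distrib-+ : ∀ {n} (f g : Fin n → ℚ) → Σℚ (λ q → f q + g q) ≡ Σℚ f + Σℚ g
Σℚ-distrib-+ {zero}  f g = refl
Σℚ-distrib-+ {suc n} f g =
  trans (cong (_+_ (f zero + g zero)) (Σℚ-distrib-+ (f ∘ suc) (g ∘ suc)))
        (interchange (f zero) (g zero) (Σℚ (f ∘ suc)) (Σℚ (g ∘ suc)))

toℚᵘ-ℕ→ℚ : ∀ m → toℚᵘ (ℕ→ℚ m) ℚᵘ.≃ ℚᵘ.mkℚᵘ (ℤ.+ m) 0
toℚᵘ-ℕ→ℚ m = ℚ.toℚᵘ-fromℚᵘ (ℚᵘ.mkℚᵘ (ℤ.+ m) 0)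

ℕ→ℚ-+ : ∀ m k → ℕ→ℚ (m ℕ.+ k) ≡ ℕ→ℚ m + ℕ→ℚ k
ℕ→ℚ-+ m k = ℚ.toℚᵘ-injective (begin
  toℚᵘ (ℕ→ℚ (m ℕ.+ k))                      ≈⟨ toℚᵘ-ℕ→ℚ (m ℕ.+ k) ⟩
  ℚᵘ.mkℚᵘ (ℤ.+ (m ℕ.+ k)) 0                 ≈⟨ ℚᵘ.*≡* (cong (ℤ._* ℤ.+ 1) (cong₂ ℤ._+_ (*1 m) (*1 k))) ⟩
  ℚᵘ.mkℚᵘ (ℤ.+ m) 0 ℚᵘ.+ ℚᵘ.mkℚᵘ (ℤ.+ k) 0   ≈⟨ ℚᵘ.+-cong (toℚᵘ-ℕ→ℚ m) (toℚᵘ-ℕ→ℚ k) ⟨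
  toℚᵘ (ℕ→ℚ m) ℚᵘ.+ toℚᵘ (ℕ→ℚ k)             ≈⟨ ℚ.toℚᵘ-homo-+ (ℕ→ℚ m) (ℕ→ℚ k) ⟨
  toℚᵘ (ℕ→ℚ m + ℕ→ℚ k)                      ∎)
  where
  open ℚᵘ.≃-Reasoning
  *1 : ∀ x → ℤ.+ x ≡ ℤ.+ x ℤ.* ℤ.+ 1
  *1 x = sym (ℤ.*-identityʳ (ℤ.+ x))

ℕ→ℚ-mono-≤ : ∀ {m k} → m ℕ.≤ k → ℕ→ℚ m ≤ℚ ℕ→ℚ k
ℕ→ℚ-mono-≤ {m} {k} m≤k = ℚ.toℚᵘ-cancel-≤ (begin
  toℚᵘ (ℕ→ℚ m)          ≃⟨ toℚᵘ-ℕ→ℚ m ⟩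
  ℚᵘ.mkℚᵘ (ℤ.+ m) 0     ≤⟨ ℚᵘ.*≤* (ℤ.*-monoʳ-≤-nonNeg (ℤ.+ 1) (ℤ.+≤+ m≤k)) ⟩
  ℚᵘ.mkℚᵘ (ℤ.+ k) 0     ≃⟨ toℚᵘ-ℕ→ℚ k ⟨
  toℚᵘ (ℕ→ℚ k)          ∎)
  where open ℚᵘ.≤-Reasoning

+-cancelˡ-≤ : ∀ r p q → r + p ≤ℚ r + q → p ≤ℚ q
+-cancelˡ-≤ r p q r+p≤r+q = subst₂ _≤ℚ_ (-r+r+ p) (-r+r+ q) (ℚ.+-monoʳ-≤ (- r) r+p≤r+q)
  where
  -r+r+ : ∀ x → - r + (r + x) ≡ x
  -r+r+ x = trans (sym (ℚ.+-assoc (- r) r x)) (trans (cong (_+ x) (ℚ.+-inverseˡ r)) (ℚ.+-identityˡ x))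

take>-lookup : ∀ {A : Set} (xs : List A) (i : Fin (length xs)) k → toℕ i ℕ.< k →
               ∃ λ ρ → take k xs ≡ take (toℕ i) xs ++ lookup xs i ∷ ρ
take>-lookup (x ∷ xs) zero    (suc k) _         = take k xs , refl
take>-lookup (x ∷ xs) (suc i) (suc k) (s≤s i<k) with take>-lookup xs i k i<k
... | ρ , eq = ρ , cong (x ∷_) eq

take-lookup-++ : ∀ {A : Set} (xs : List A) (j : Fin (length xs)) →
                 ∃ λ rest → xs ≡ (take (toℕ j) xs ++ lookup xs j ∷ []) ++ rest
take-lookup-++ (x ∷ xs) zero    = xs , refl
take-lookup-++ (x ∷ xs) (suc j) with take-lookup-++ xs j
... | rest , eq = rest , cong (x ∷_) eq

-- Query sets and trees

[_] : Bool → ℕ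
[ b ] = if b then 1 else 0

QuerySet : ℕ → Set
QuerySet n = Fin n → Bool

does-true : ∀ {A : Set} (a? : Dec A) → does a? ≡ true → A
does-true (yes a) _  = a
does-true (no _)  ()

does-false : ∀ {A : Set} (a? : Dec A) → does a? ≡ false → ¬ A
does-false (yes _)  ()
does-false (no ¬a) _ = ¬a

module _ {n : ℕ} where

  infixr 7 _∩_
  _∩_ : QuerySet n → QuerySet n → QuerySet n
  (X ∩ Y) q = X q ∧ Y q

  infix 4 _⊆_
  _⊆_ : QuerySet n → QuerySet n → Set
  X ⊆ Y = ∀ q → X q ≡ true → Y q ≡ true

  ∩⁺ : ∀ {X Y : QuerySet n} q → X q ≡ true → Y q ≡ true → (X ∩ Y) q ≡ true
  ∩⁺ q Xq Yq rewrite Xq = Yq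

  ∩-⊆ˡ : ∀ (X Y : QuerySet n) → X ∩ Y ⊆ X
  ∩-⊆ˡ X Y q = ∧-conicalˡ (X q) (Y q)

  ∩-⊆ʳ : ∀ (X Y : QuerySet n) → X ∩ Y ⊆ Y
  ∩-⊆ʳ X Y q = ∧-conicalʳ (X q) (Y q)

  ∩-monoˡ : ∀ {X Y : QuerySet n} Z → X ⊆ Y → X ∩ Z ⊆ Y ∩ Z
  ∩-monoˡ {X} {Y} Z X⊆Y q e = ∩⁺ {Y} {Z} q (X⊆Y q (∩-⊆ˡ X Z q e)) (∩-⊆ʳ X Z q e)

  ∩-restrict : ∀ (Z X : QuerySet n) {A} → X ⊆ A → Z ∩ X ⊆ (Z ∩ A) ∩ X
  ∩-restrict Z X {A} X⊆A q e =
    ∩⁺ {Z ∩ A} {X} q (∩⁺ {Z} {A} q (∩-⊆ˡ Z X q e) (X⊆A q (∩-⊆ʳ Z X q e))) (∩-⊆ʳ Z X q e)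

  ∩-distribʳ : ∀ (Z X A : QuerySet n) → (Z ∩ X) ∩ A ⊆ (Z ∩ A) ∩ (X ∩ A)
  ∩-distribʳ Z X A q e =
    ∩⁺ {Z ∩ A} {X ∩ A} q (∩⁺ {Z} {A} q (∩-⊆ˡ Z X q Z∩X) Aq) (∩⁺ {X} {A} q (∩-⊆ʳ Z X q Z∩X) Aq)
    where
    Z∩X = ∩-⊆ˡ (Z ∩ X) A q e
    Aq  = ∩-⊆ʳ (Z ∩ X) A q e

  ≗⇒⊆ : ∀ {X Y : QuerySet n} → X ≗ Y → X ⊆ Y
  ≗⇒⊆ X≗Y q e = trans (sym (X≗Y q)) e

  reaching : Tree n → Address → QuerySet n
  reaching T a q = reaches T q a

  answers : Test n → Bool → QuerySet n
  answers t b q = if b then sat t q else not (sat t q)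

  answers-sound : ∀ {t b q} → answers t b q ≡ true → sat t q ≡ b
  answers-sound {b = true}  e = e
  answers-sound {b = false} e = trans (sym (not-involutive _)) (cong not e)

  answers-complete : ∀ {t b q} → sat t q ≡ b → answers t b q ≡ true
  answers-complete {b = true}  e = e
  answers-complete {b = false} e = cong not e

  answers-not : ∀ t b q → answers t (not b) q ≡ not (answers t b q)
  answers-not t true  q = refl
  answers-not t false q = sym (not-involutive (sat t q))

  Forces : Test n × Bool → Test n × Bool → Set
  Forces (t₁ , b₁) (t₂ , b₂) = ∀ q → sat t₁ q ≡ b₁ → sat t₂ q ≡ b₂

  lt-sound : ∀ (k q : Fin n) → sat (lt k) q ≡ true → toℕ q ℕ.< toℕ k
  lt-sound k q = does-true (q <? k)

  lt-sound-false : ∀ (k q : Fin n) → sat (lt k) q ≡ false → toℕ k ℕ.≤ toℕ q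
  lt-sound-false k q e = ℕ.≮⇒≥ (does-false (q <? k) e)

  lt-complete : ∀ (k q : Fin n) → toℕ q ℕ.< toℕ k → sat (lt k) q ≡ true
  lt-complete k q = dec-true (q <? k)

  lt-complete-false : ∀ (k q : Fin n) → toℕ k ℕ.≤ toℕ q → sat (lt k) q ≡ false
  lt-complete-false k q k≤q = dec-false (q <? k) (ℕ.≤⇒≯ k≤q)

  eqt-sound : ∀ (k q : Fin n) → sat (eqt k) q ≡ true → q ≡ k
  eqt-sound k q = does-true (q ≟ k)

  eqt-avoided : ∀ t {b} (k : Fin n) → sat t k ≡ not b → Forces (t , b) (eqt k , false)
  eqt-avoided t k tk≡¬b q tq≡b = dec-false (q ≟ k) λ q≡k →
    not-¬ (trans (cong (sat t) (sym q≡k)) tq≡b) tk≡¬b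

  subtree-++ : ∀ (T : Tree n) β γ {U} → subtree T β ≡ just U → subtree T (β ++ γ) ≡ subtree U γ
  subtree-++ T            []          γ refl = refl
  subtree-++ (node t y z) (true ∷ β)  γ e    = subtree-++ y β γ e
  subtree-++ (node t y z) (false ∷ β) γ e    = subtree-++ z β γ e

  subtree-child : ∀ (T : Tree n) β {t y z} → subtree T β ≡ just (node t y z) →
                  ∀ b → subtree T (β ++ b ∷ []) ≡ just (if b then y else z)
  subtree-child T β e true  = subtree-++ T β (true ∷ []) e
  subtree-child T β e false = subtree-++ T β (false ∷ []) e

  subtree-prefix : ∀ (T : Tree n) β b γ {u} → subtree T (β ++ b ∷ γ) ≡ just u →
                   ∃ λ t → ∃₂ λ y z → subtree T β ≡ just (node t y z)
  subtree-prefix (node t y z) []          b γ e = t , y , z , refl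
  subtree-prefix (node t y z) (true ∷ β)  b γ e = subtree-prefix y β b γ e
  subtree-prefix (node t y z) (false ∷ β) b γ e = subtree-prefix z β b γ e

  testAt-node : ∀ (T : Tree n) a {t} → testAt T a ≡ just t → ∃₂ λ y z → subtree T a ≡ just (node t y z)
  testAt-node T a e with subtree T a
  testAt-node T a refl | just (node t y z) = y , z , refl

  reaches-++ : ∀ (T : Tree n) β γ q {U} → subtree T β ≡ just U →
               reaches T q (β ++ γ) ≡ reaches T q β ∧ reaches U q γ
  reaches-++ T            []          γ q refl = refl
  reaches-++ (node t y z) (true ∷ β)  γ q e with sat t q
  ... | true  = reaches-++ y β γ q e
  ... | false = refl
  reaches-++ (node t y z) (false ∷ β) γ q e with sat t q
  ... | true  = refl
  ... | false = reaches-++ z β γ q e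

  reaches-prefix : ∀ (T : Tree n) β γ q → reaches T q (β ++ γ) ≡ true → reaches T q β ≡ true
  reaches-prefix T            []          γ q r = refl
  reaches-prefix (node t y z) (true ∷ β)  γ q r with sat t q
  ... | true = reaches-prefix y β γ q r
  reaches-prefix (node t y z) (false ∷ β) γ q r with sat t q
  ... | false = reaches-prefix z β γ q r

  reaches-root-child : ∀ t (y z : Tree n) b q → reaches (node t y z) q (b ∷ []) ≡ answers t b q
  reaches-root-child t y z true  q with sat t q
  ... | true  = refl
  ... | false = refl
  reaches-root-child t y z false q with sat t q
  ... | true  = refl
  ... | false = refl

  reaches-child : ∀ (T : Tree n) β b q {t y z} → subtree T β ≡ just (node t y z) →
               reaches T q (β ++ b ∷ []) ≡ (reaching T β ∩ answers t b) q
  reaches-child T β b q {t} {y} {z} e =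
    trans (reaches-++ T β (b ∷ []) q e) (cong (reaches T q β ∧_) (reaches-root-child t y z b q))

  reaches-cons : ∀ t (y z : Tree n) b α q →
                 reaches (node t y z) q (b ∷ α) ≡ answers t b q ∧ reaches (if b then y else z) q α
  reaches-cons t y z true  α q with sat t q
  ... | true  = refl
  ... | false = refl
  reaches-cons t y z false α q with sat t q
  ... | true  = refl
  ... | false = refl

  reaching-cons : ∀ X t (y z : Tree n) b α →
                  X ∩ reaching (node t y z) (b ∷ α) ≗ (X ∩ answers t b) ∩ reaching (if b then y else z) α
  reaching-cons X t y z b α q = trans (cong (X q ∧_) (reaches-cons t y z b α q)) (sym (∧-assoc (X q) _ _))

  reaches-answer : ∀ (T : Tree n) β b γ q {t y z} → subtree T β ≡ just (node t y z) →
                   reaches T q (β ++ b ∷ γ) ≡ true → sat t q ≡ b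
  reaches-answer T β b γ q {t} e r = answers-sound {t} {b} {q} (∩-⊆ʳ (reaching T β) (answers t b) q at-child)
    where
    at-child : (reaching T β ∩ answers t b) q ≡ true
    at-child = trans (sym (reaches-child T β b q e))
                     (reaches-prefix T (β ++ b ∷ []) γ q (subst (λ a → reaches T q a ≡ true) (sym (∷ʳ-++ β b γ)) r))

  depth-subtree : ∀ (T : Tree n) α q {U} → subtree T α ≡ just U → reaches T q α ≡ true →
                  depth T q ≡ length α ℕ.+ depth U q
  depth-subtree T            []          q refl _ = refl
  depth-subtree (node t y z) (true ∷ α)  q e    r with sat t q
  ... | true  = cong suc (depth-subtree y α q e r)
  depth-subtree (node t y z) (false ∷ α) q e    r with sat t q
  ... | false = cong suc (depth-subtree z α q e r)

  replace : Tree n → Address → Tree n → Tree n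
  replace T            []          N = N
  replace (leaf C)     (_ ∷ _)     N = leaf C
  replace (node t y z) (true ∷ a)  N = node t (replace y a N) z
  replace (node t y z) (false ∷ a) N = node t y (replace z a N)

  depth-replace : ∀ (T : Tree n) α N q {U} → subtree T α ≡ just U → reaches T q α ≡ true →
                  depth (replace T α N) q ≡ length α ℕ.+ depth N q
  depth-replace T            []          N q refl _ = refl
  depth-replace (node t y z) (true ∷ α)  N q e    r with sat t q
  ... | true  = cong suc (depth-replace y α N q e r)
  depth-replace (node t y z) (false ∷ α) N q e    r with sat t q
  ... | false = cong suc (depth-replace z α N q e r)

  depth-replace-out : ∀ (T : Tree n) α N q → reaches T q α ≡ false → depth (replace T α N) q ≡ depth T q
  depth-replace-out (leaf C)     (_ ∷ _)     N q r = refl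
  depth-replace-out (node t y z) (true ∷ α)  N q r with sat t q
  ... | true  = cong suc (depth-replace-out y α N q r)
  ... | false = refl
  depth-replace-out (node t y z) (false ∷ α) N q r with sat t q
  ... | true  = refl
  ... | false = cong suc (depth-replace-out z α N q r)

  replace-depth-≤ : ∀ (T : Tree n) α {U} → subtree T α ≡ just U → ∀ N γ δ →
                    (∀ q → depth N q ℕ.+ [ reaches U q γ ] ℕ.≤ depth U q ℕ.+ [ reaches U q δ ]) →
                    ∀ q → depth (replace T α N) q ℕ.+ [ reaches T q (α ++ γ) ] ℕ.≤
                          depth T q ℕ.+ [ reaches T q (α ++ δ) ]
  replace-depth-≤ T α {U} uα N γ δ N≤U q =
    subst₂ ℕ._≤_ (cong (λ b → depth (replace T α N) q ℕ.+ [ b ]) (sym (reaches-++ T α γ q uα)))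
                 (cong (λ b → depth T q ℕ.+ [ b ]) (sym (reaches-++ T α δ q uα)))
                 (by-reach (reaches T q α) refl)
    where
    by-reach : ∀ b → reaches T q α ≡ b →
               depth (replace T α N) q ℕ.+ [ b ∧ reaches U q γ ] ℕ.≤ depth T q ℕ.+ [ b ∧ reaches U q δ ]
    by-reach true r rewrite depth-replace T α N q uα r | depth-subtree T α q uα r = begin
      length α ℕ.+ depth N q ℕ.+ [ reaches U q γ ]     ≡⟨ ℕ.+-assoc (length α) _ _ ⟩
      length α ℕ.+ (depth N q ℕ.+ [ reaches U q γ ])   ≤⟨ ℕ.+-monoʳ-≤ (length α) (N≤U q) ⟩
      length α ℕ.+ (depth U q ℕ.+ [ reaches U q δ ])   ≡⟨ ℕ.+-assoc (length α) _ _ ⟨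
      length α ℕ.+ depth U q ℕ.+ [ reaches U q δ ]     ∎
      where open ℕ.≤-Reasoning
    by-reach false r rewrite depth-replace-out T α N q r = ℕ.≤-refl

  subtree-reassoc : ∀ (T : Tree n) α p ρ {u} → subtree T (α ++ p ∷ ρ) ≡ just u →
                    subtree T ((α ++ p ∷ []) ++ ρ) ≡ just u
  subtree-reassoc T α p ρ = subst (λ β → subtree T β ≡ _) (sym (∷ʳ-++ α p ρ))

  -- Pruning

  Nonempty : QuerySet n → Set
  Nonempty X = ∃ λ q → X q ≡ true

  nonempty? : ∀ X → Dec (Nonempty X)
  nonempty? X = any? (λ q → X q ≟ᵇ true)

  data Split (X : QuerySet n) (t : Test n) : Set where
    constant : ∀ b → X ⊆ answers t b → Split X t
    splits   : Nonempty (X ∩ answers t true) → Nonempty (X ∩ answers t false) → Split X t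

  empty-side : ∀ {X} t b → ¬ Nonempty (X ∩ answers t b) → X ⊆ answers t (not b)
  empty-side {X} t b ∄ q Xq =
    trans (answers-not t b q) (cong not (¬-not λ e → ∄ (q , ∩⁺ {X} {answers t b} q Xq e)))

  split : ∀ X t → Split X t
  split X t with nonempty? (X ∩ answers t true) | nonempty? (X ∩ answers t false)
  ... | no ∄yes | _       = constant false (empty-side t true ∄yes)
  ... | yes _   | no ∄no  = constant true (empty-side t false ∄no)
  ... | yes ∃yes | yes ∃no = splits ∃yes ∃no

  saved : ∀ {X t} → Split X t → ℕ
  saved (constant _ _) = 1
  saved (splits _ _)   = 0

  saved-constant : ∀ {X t b} → X ⊆ answers t b → saved (split X t) ≡ 1
  saved-constant {X} {t} {b} X⊆ with split X t
  ... | constant _ _ = refl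
  ... | splits (q₁ , e₁) (q₂ , e₂) = ⊥-elim (true≢false (trans (side q₁ e₁) (sym (side q₂ e₂))))
    where
    true≢false : ¬ true ≡ false
    true≢false ()
    side : ∀ {c} q → (X ∩ answers t c) q ≡ true → c ≡ b
    side {c} q e = trans (sym (answers-sound {t} {c} {q} (∩-⊆ʳ X (answers t c) q e)))
                         (answers-sound {t} {b} {q} (X⊆ q (∩-⊆ˡ X (answers t c) q e)))

  saved-mono : ∀ {X Y} t → Y ⊆ X → saved (split X t) ℕ.≤ saved (split Y t)
  saved-mono {X} t Y⊆X with split X t
  ... | constant b X⊆ = ℕ.≤-reflexive (sym (saved-constant (λ q → X⊆ q ∘ Y⊆X q)))
  ... | splits _ _    = z≤n

  prune : QuerySet n → Tree n → Tree n
  prune X (leaf C) = leaf C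
  prune X (node t y z) with split X t
  ... | constant true  _ = prune X y
  ... | constant false _ = prune X z
  ... | splits _ _       = node t (prune (X ∩ answers t true) y) (prune (X ∩ answers t false) z)

  savings : QuerySet n → Tree n → Fin n → ℕ
  savings X (leaf _)     q = 0
  savings X (node t y z) q = saved (split X t) ℕ.+ (if sat t q then savings X y q else savings X z q)

  savings-mono : ∀ {X Y} → Y ⊆ X → ∀ T q → savings X T q ℕ.≤ savings Y T q
  savings-mono Y⊆X (leaf _)     q = z≤n
  savings-mono Y⊆X (node t y z) q with sat t q
  ... | true  = ℕ.+-mono-≤ (saved-mono t Y⊆X) (savings-mono Y⊆X y q)
  ... | false = ℕ.+-mono-≤ (saved-mono t Y⊆X) (savings-mono Y⊆X z q)

  prune-depth : ∀ X (T : Tree n) q → X q ≡ true → depth (prune X T) q ℕ.+ savings X T q ℕ.≤ depth T q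
  prune-depth X (leaf _)     q Xq = z≤n
  prune-depth X (node t y z) q Xq with split X t
  ... | constant true X⊆ rewrite X⊆ q Xq | ℕ.+-suc (depth (prune X y) q) (savings X y q) =
    s≤s (prune-depth X y q Xq)
  ... | constant false X⊆ rewrite answers-sound {t} {false} {q} (X⊆ q Xq)
                                | ℕ.+-suc (depth (prune X z) q) (savings X z q) =
    s≤s (prune-depth X z q Xq)
  ... | splits _ _ with sat t q in e
  ...   | true  = s≤s (ℕ.≤-trans (ℕ.+-monoʳ-≤ _ (savings-mono (∩-⊆ˡ X (answers t true)) y q))
                                 (prune-depth _ y q (∩⁺ {X} {answers t true} q Xq e)))
  ...   | false = s≤s (ℕ.≤-trans (ℕ.+-monoʳ-≤ _ (savings-mono (∩-⊆ˡ X (answers t false)) z q))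
                                 (prune-depth _ z q (∩⁺ {X} {answers t false} q Xq (cong not e))))

  savingsAlong : QuerySet n → Tree n → Address → ℕ
  savingsAlong X (leaf _)     _           = 0
  savingsAlong X (node t y z) []          = 0
  savingsAlong X (node t y z) (true ∷ δ)  = saved (split X t) ℕ.+ savingsAlong X y δ
  savingsAlong X (node t y z) (false ∷ δ) = saved (split X t) ℕ.+ savingsAlong X z δ

  savingsAlong-root : ∀ X t (y z : Tree n) b δ → saved (split X t) ℕ.≤ savingsAlong X (node t y z) (b ∷ δ)
  savingsAlong-root X t y z true  δ = ℕ.m≤m+n _ _
  savingsAlong-root X t y z false δ = ℕ.m≤m+n _ _

  savingsAlong-< : ∀ X (U : Tree n) δ q {t y z} → subtree U δ ≡ just (node t y z) → reaches U q δ ≡ true →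
               saved (split X t) ≡ 1 → savingsAlong X U δ ℕ.< savings X U q
  savingsAlong-< X U [] q refl _ saved≡1 rewrite saved≡1 = s≤s z≤n
  savingsAlong-< X (node t₀ y₀ z₀) (true ∷ δ) q e r saved≡1 with sat t₀ q
  ... | true  = ℕ.+-monoʳ-< (saved (split X t₀)) (savingsAlong-< X y₀ δ q e r saved≡1)
  savingsAlong-< X (node t₀ y₀ z₀) (false ∷ δ) q e r saved≡1 with sat t₀ q
  ... | false = ℕ.+-monoʳ-< (saved (split X t₀)) (savingsAlong-< X z₀ δ q e r saved≡1)

  splitOn : Test n → Tree n → Tree n
  splitOn t U = node t (prune (answers t true) U) (prune (answers t false) U)

  depth-splitOn : ∀ t U q → depth (splitOn t U) q ≡ suc (depth (prune (answers t (sat t q)) U) q)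
  depth-splitOn t U q with sat t q
  ... | true  = refl
  ... | false = refl

  saved-forced : ∀ tj t {b v} → Forces (tj , b) (t , v) → ∀ q → sat tj q ≡ b →
                 saved (split (answers tj (sat tj q)) t) ≡ 1
  saved-forced tj t {b} {v} F q tj≡b = saved-constant λ q′ e →
    answers-complete {t} {v} {q′} (F q′ (trans (answers-sound {tj} {sat tj q} {q′} e) tj≡b))

  module _ {tk yk zk} p {t′ y′ z′} (u′ : subtree (node tk yk zk) (p ∷ []) ≡ just (node t′ y′ z′))
           ρ {tj yj zj} (uj : subtree (node tk yk zk) (p ∷ ρ) ≡ just (node tj yj zj))
           c {v v′} (F : Forces (tj , c) (tk , v)) (F′ : Forces (tj , not c) (t′ , v′)) where

    private
      U : Tree n
      U = node tk yk zk

    -- A query with tk ≠ p lies in the sibling and is paid for by the indicator on the right. Any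
    -- other query passes tk, constant on the side tj = c, and t′, constant on the side tj = not c;
    -- if it reaches the c-child of tj it also passes tj, constant on that side as well.
    savings-bound : ∀ q → suc [ reaches U q (p ∷ ρ ++ c ∷ []) ] ℕ.≤
                          savings (answers tj (sat tj q)) U q ℕ.+ [ reaches U q (not p ∷ []) ]
    savings-bound q with sat tk q ≟ᵇ p
    ... | no tk≢p rewrite ¬-not (tk≢p ∘ reaches-answer U [] p (ρ ++ c ∷ []) q refl)
                        | trans (reaches-root-child tk yk zk (not p) q) (answers-complete {tk} {not p} {q} (¬-not tk≢p)) =
      ℕ.m≤n+m 1 _
    ... | yes tk≡p = ℕ.≤-trans passing (ℕ.m≤m+n _ _)
      where
      X = answers tj (sat tj q)
      passing : suc [ reaches U q (p ∷ ρ ++ c ∷ []) ] ℕ.≤ savings X U q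
      passing with sat tj q ≟ᵇ c
      ... | yes tj≡c with reaches U q (p ∷ ρ ++ c ∷ []) in r
      ...   | true  = ℕ.≤-trans (s≤s (ℕ.≤-trans (ℕ.≤-reflexive (sym (saved-forced tj tk F q tj≡c)))
                                                 (savingsAlong-root X tk yk zk p ρ)))
                                (savingsAlong-< X U (p ∷ ρ) q uj (reaches-prefix U (p ∷ ρ) (c ∷ []) q r)
                                            (saved-forced tj tj (λ _ e → e) q tj≡c))
      ...   | false = savingsAlong-< X U [] q refl refl (saved-forced tj tk F q tj≡c)
      passing | no tj≢c rewrite ¬-not (tj≢c ∘ reaches-answer U (p ∷ ρ) c [] q uj) =
        ℕ.≤-trans (s≤s z≤n)
          (savingsAlong-< X U (p ∷ []) q u′
                          (trans (reaches-root-child tk yk zk p q) (answers-complete {tk} {p} {q} tk≡p))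
                      (saved-forced tj t′ F′ q (¬-not tj≢c)))

    splitOn-depth : ∀ q → depth (splitOn tj U) q ℕ.+ [ reaches U q (p ∷ ρ ++ c ∷ []) ] ℕ.≤
                          depth U q ℕ.+ [ reaches U q (not p ∷ []) ]
    splitOn-depth q =
      transfer (depth-splitOn tj U q)
               (prune-depth (answers tj (sat tj q)) U q (answers-complete {tj} {sat tj q} {q} refl))
               (savings-bound q)
      where
      transfer : ∀ {dN dp s d y z} → dN ≡ suc dp → dp ℕ.+ s ℕ.≤ d → suc y ℕ.≤ s ℕ.+ z →
                 dN ℕ.+ y ℕ.≤ d ℕ.+ z
      transfer {dN} {dp} {s} {d} {y} {z} dN≡1+dp dp+s≤d 1+y≤s+z = begin
        dN ℕ.+ y           ≡⟨ cong (ℕ._+ y) dN≡1+dp ⟩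
        suc (dp ℕ.+ y)     ≡⟨ ℕ.+-suc dp y ⟨
        dp ℕ.+ suc y       ≤⟨ ℕ.+-monoʳ-≤ dp 1+y≤s+z ⟩
        dp ℕ.+ (s ℕ.+ z)   ≡⟨ ℕ.+-assoc dp s z ⟨
        dp ℕ.+ s ℕ.+ z     ≤⟨ ℕ.+-monoˡ-≤ z dp+s≤d ⟩
        d ℕ.+ z            ∎
        where open ℕ.≤-Reasoning

module _ (I : Instance) where
  open Instance I

  ValidOn : QuerySet n → Tree n → Set
  ValidOn X (leaf C)     = C ∈ₗ classes × (∀ q → X q ≡ true → q ∈ₛ C)
  ValidOn X (node t y z) = Allowed I t × ValidOn (X ∩ answers t true) y × ValidOn (X ∩ answers t false) z

  ValidOn-⊆ : ∀ {X Y} (T : Tree n) → X ⊆ Y → ValidOn Y T → ValidOn X T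
  ValidOn-⊆ (leaf C)     X⊆Y (C∈ , Y⊆C)   = C∈ , λ q → Y⊆C q ∘ X⊆Y q
  ValidOn-⊆ (node t y z) X⊆Y (al , vy , vz) =
    al , ValidOn-⊆ y (∩-monoˡ (answers t true) X⊆Y) vy , ValidOn-⊆ z (∩-monoˡ (answers t false) X⊆Y) vz

  ValidOn-subtree : ∀ X (T : Tree n) α {U} → ValidOn X T → subtree T α ≡ just U → ValidOn (X ∩ reaching T α) U
  ValidOn-subtree X T [] v refl = ValidOn-⊆ T (∩-⊆ˡ X (λ _ → true)) v
  ValidOn-subtree X (node t y z) (true ∷ α) {U} (_ , vy , _) e =
    ValidOn-⊆ U (≗⇒⊆ (reaching-cons X t y z true α)) (ValidOn-subtree (X ∩ answers t true) y α vy e)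
  ValidOn-subtree X (node t y z) (false ∷ α) {U} (_ , _ , vz) e =
    ValidOn-⊆ U (≗⇒⊆ (reaching-cons X t y z false α)) (ValidOn-subtree (X ∩ answers t false) z α vz e)

  ValidOn-replace : ∀ X (T : Tree n) α N {U} → ValidOn X T → subtree T α ≡ just U →
                    ValidOn (X ∩ reaching T α) N → ValidOn X (replace T α N)
  ValidOn-replace X T [] N v refl vN = ValidOn-⊆ N (λ q Xq → ∩⁺ {X = X} {λ _ → true} q Xq refl) vN
  ValidOn-replace X (node t y z) (true ∷ α) N (al , vy , vz) e vN =
    al , ValidOn-replace (X ∩ answers t true) y α N vy e
                         (ValidOn-⊆ N (≗⇒⊆ (sym ∘ reaching-cons X t y z true α)) vN) , vz
  ValidOn-replace X (node t y z) (false ∷ α) N (al , vy , vz) e vN =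
    al , vy , ValidOn-replace (X ∩ answers t false) z α N vz e
                              (ValidOn-⊆ N (≗⇒⊆ (sym ∘ reaching-cons X t y z false α)) vN)

  ValidOn-reaching : ∀ {T} → IsDecisionTree I T → ∀ a {U} → subtree T a ≡ just U → ValidOn (reaching T a) U
  ValidOn-reaching (_ , leaves) a {leaf C} e = leaves a C e
  ValidOn-reaching {T} dt@(allowed , _) a {node t y z} e =
    allowed a t y z e ,
    ValidOn-⊆ y (≗⇒⊆ (λ q → sym (reaches-child T a true q e)))
                (ValidOn-reaching dt (a ++ true ∷ []) {y} (subtree-child T a e true)) ,
    ValidOn-⊆ z (≗⇒⊆ (λ q → sym (reaches-child T a false q e)))
                (ValidOn-reaching dt (a ++ false ∷ []) {z} (subtree-child T a e false))

  ValidOn-prune : ∀ Z X (T : Tree n) → ValidOn Z T → ValidOn (Z ∩ X) (prune X T)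
  ValidOn-prune Z X (leaf C) (C∈ , Z⊆C) = C∈ , λ q e → Z⊆C q (∩-⊆ˡ Z X q e)
  ValidOn-prune Z X (node t y z) (al , vy , vz) with split X t
  ... | constant true  X⊆ = ValidOn-⊆ (prune X y) (∩-restrict Z X X⊆) (ValidOn-prune (Z ∩ answers t true) X y vy)
  ... | constant false X⊆ = ValidOn-⊆ (prune X z) (∩-restrict Z X X⊆) (ValidOn-prune (Z ∩ answers t false) X z vz)
  ... | splits _ _ =
    al , ValidOn-⊆ _ (∩-distribʳ Z X (answers t true))
                     (ValidOn-prune (Z ∩ answers t true) (X ∩ answers t true) y vy)
       , ValidOn-⊆ _ (∩-distribʳ Z X (answers t false))
                     (ValidOn-prune (Z ∩ answers t false) (X ∩ answers t false) z vz)

  weightOf : QuerySet n → ℚ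
  weightOf X = Σℚ λ q → if X q then w q else 0ℚ

  weightOf-mono : ∀ {X Y} → X ⊆ Y → weightOf X ≤ℚ weightOf Y
  weightOf-mono {X} {Y} X⊆Y = Σℚ-mono-≤ term-≤
    where
    term-≤ : ∀ q → (if X q then w q else 0ℚ) ≤ℚ (if Y q then w q else 0ℚ)
    term-≤ q with X q in e
    ... | true rewrite X⊆Y q e = ℚ.≤-refl
    ... | false with Y q
    ...   | true  = w≥0 q
    ...   | false = ℚ.≤-refl

  weight-++-≤ : ∀ (T : Tree n) β γ → weight I T (β ++ γ) ≤ℚ weight I T β
  weight-++-≤ T β γ = weightOf-mono (λ q → reaches-prefix T β γ q)

  weighted : (Fin n → ℕ) → ℚ
  weighted d = Σℚ λ q → w q * ℕ→ℚ (d q)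

  weighted-+-weightOf : ∀ (d : Fin n → ℕ) X → weighted (λ q → d q ℕ.+ [ X q ]) ≡ weighted d + weightOf X
  weighted-+-weightOf d X =
    trans (Σℚ-cong term) (Σℚ-distrib-+ (λ q → w q * ℕ→ℚ (d q)) (λ q → if X q then w q else 0ℚ))
    where
    indicator : ∀ q b → w q * ℕ→ℚ [ b ] ≡ (if b then w q else 0ℚ)
    indicator q true  = ℚ.*-identityʳ (w q)
    indicator q false = ℚ.*-zeroʳ (w q)
    term : ∀ q → w q * ℕ→ℚ (d q ℕ.+ [ X q ]) ≡ w q * ℕ→ℚ (d q) + (if X q then w q else 0ℚ)
    term q = trans (cong (w q *_) (ℕ→ℚ-+ (d q) [ X q ]))
                   (trans (ℚ.*-distribˡ-+ (w q) _ _) (cong (_+_ (w q * ℕ→ℚ (d q))) (indicator q (X q))))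

  weighted-mono : ∀ {d₁ d₂ : Fin n → ℕ} → (∀ q → d₁ q ℕ.≤ d₂ q) → weighted d₁ ≤ℚ weighted d₂
  weighted-mono d₁≤d₂ =
    Σℚ-mono-≤ λ q → ℚ.*-monoˡ-≤-nonNeg (w q) ⦃ nonNegative (w≥0 q) ⦄ (ℕ→ℚ-mono-≤ (d₁≤d₂ q))

  ValidOn⇒IsDecisionTree : ∀ {T} → ValidOn (λ _ → true) T → IsDecisionTree I T
  ValidOn⇒IsDecisionTree {T} v =
    (λ a t y z e → proj₁ (ValidOn-subtree _ T a v e)) , (λ a C → ValidOn-subtree _ T a v)

  exchange : ∀ {T} → MinimumCost I T → ∀ α {U} → subtree T α ≡ just U →
             ∀ N → ValidOn (reaching T α) N →
             ∀ γ δ → (∀ q → depth N q ℕ.+ [ reaches U q γ ] ℕ.≤ depth U q ℕ.+ [ reaches U q δ ]) →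
             weight I T (α ++ γ) ≤ℚ weight I T (α ++ δ)
  exchange {T} (dt , optimal) α {U} uα N vN γ δ N≤U = +-cancelˡ-≤ (cost I T′) _ _ (begin
    cost I T′ + weight I T (α ++ γ)
      ≡⟨ weighted-+-weightOf (depth T′) (reaching T (α ++ γ)) ⟨
    weighted (λ q → depth T′ q ℕ.+ [ reaches T q (α ++ γ) ])
      ≤⟨ weighted-mono (replace-depth-≤ T α uα N γ δ N≤U) ⟩
    weighted (λ q → depth T q ℕ.+ [ reaches T q (α ++ δ) ])
      ≡⟨ weighted-+-weightOf (depth T) (reaching T (α ++ δ)) ⟩
    cost I T + weight I T (α ++ δ)
      ≤⟨ ℚ.+-monoˡ-≤ _ (optimal T′ valid′) ⟩
    cost I T′ + weight I T (α ++ δ)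
      ∎)
    where
    open ℚ.≤-Reasoning
    T′ = replace T α N
    valid′ : IsDecisionTree I T′
    valid′ = ValidOn⇒IsDecisionTree (ValidOn-replace (λ _ → true) T α N (ValidOn-reaching dt [] refl) uα vN)

  consistent? : ∀ o₁ o₂ → Dec (Consistent I o₁ o₂)
  consistent? (t₁ , b₁) (t₂ , b₂) = any? λ q → (sat t₁ q ≟ᵇ b₁) ×-dec (sat t₂ q ≟ᵇ b₂)

  consistent-sym : ∀ o₁ o₂ → Consistent I o₁ o₂ → Consistent I o₂ o₁
  consistent-sym _ _ (q , e₁ , e₂) = q , e₂ , e₁

  inconsistent⇒forces : ∀ t₁ b₁ t₂ b₂ → ¬ Consistent I (t₁ , b₁) (t₂ , b₂) →
                        Forces (t₂ , b₂) (t₁ , not b₁)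
  inconsistent⇒forces _ _ _ _ ∄ q e₂ = ¬-not λ e₁ → ∄ (q , e₁ , e₂)

  -- The queries failing (tm , pm) form a prefix, a suffix, a point or the complement of a point
  -- of Q; when both sides of tj meet (tm , pm), such a set lies on one side of tj.
  forcing-dichotomyᵗ : ∀ {tm pm tj} → Consistent I (tm , pm) (tj , true) → Consistent I (tm , pm) (tj , false) →
                       Forces (tj , true) (tm , pm) ⊎ Forces (tj , false) (tm , pm)
  forcing-dichotomyᵗ {tm} {tj = eqt c} (a , ma , ja) _ =
    inj₁ λ q qc → trans (cong (sat tm) (trans (eqt-sound c q qc) (sym (eqt-sound c a ja)))) ma
  forcing-dichotomyᵗ {eqt k} {true} {lt c} (a , ma , ja) (b , mb , jb) =
    ⊥-elim (not-¬ (trans (cong (sat (lt c)) (trans (eqt-sound k b mb) (sym (eqt-sound k a ma)))) ja) jb)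
  forcing-dichotomyᵗ {eqt k} {false} {lt c} _ _ with sat (lt c) k in e
  ... | true  = inj₂ (eqt-avoided (lt c) k e)
  ... | false = inj₁ (eqt-avoided (lt c) k e)
  forcing-dichotomyᵗ {lt k} {true} {lt c} _ (b , mb , jb) = inj₁ λ q qc →
    lt-complete k q (ℕ.<-≤-trans (lt-sound c q qc)
                                 (ℕ.<⇒≤ (ℕ.≤-<-trans (lt-sound-false c b jb) (lt-sound k b mb))))
  forcing-dichotomyᵗ {lt k} {false} {lt c} (a , ma , ja) _ = inj₂ λ q qc →
    lt-complete-false k q (ℕ.<⇒≤ (ℕ.≤-<-trans (lt-sound-false k a ma)
                                               (ℕ.<-≤-trans (lt-sound c a ja) (lt-sound-false c q qc))))

  forcing-dichotomy : ∀ {tm pm tj pj} → Consistent I (tm , pm) (tj , pj) → Consistent I (tm , pm) (tj , not pj) →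
                      Forces (tj , pj) (tm , pm) ⊎ Forces (tj , not pj) (tm , pm)
  forcing-dichotomy {tm} {pm} {tj} {true}  c₁ c₂ = forcing-dichotomyᵗ {tm} {pm} {tj} c₁ c₂
  forcing-dichotomy {tm} {pm} {tj} {false} c₁ c₂ = swap (forcing-dichotomyᵗ {tm} {pm} {tj} c₂ c₁)

  module _ {T : Tree n} (mc : MinimumCost I T) where

    exchange-bound : ∀ α {tk yk zk} → subtree T α ≡ just (node tk yk zk) →
                     ∀ p {t′ y′ z′} → subtree T (α ++ p ∷ []) ≡ just (node t′ y′ z′) →
                     ∀ ρ {tj yj zj} → subtree T (α ++ p ∷ ρ) ≡ just (node tj yj zj) →
                     ∀ c {v v′} → Forces (tj , c) (tk , v) → Forces (tj , not c) (t′ , v′) →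
                     weight I T (α ++ p ∷ ρ ++ c ∷ []) ≤ℚ weight I T (α ++ not p ∷ [])
    exchange-bound α {tk} {yk} {zk} uk p u′ ρ {tj} uj c F F′ =
      exchange mc α uk (splitOn tj U) valid (p ∷ ρ ++ c ∷ []) (not p ∷ [])
               (splitOn-depth p (within u′) ρ (within uj) c F F′)
      where
      U = node tk yk zk
      within : ∀ {γ u} → subtree T (α ++ γ) ≡ just u → subtree U γ ≡ just u
      within {γ} e = trans (sym (subtree-++ T α γ uk)) e
      vU : ValidOn (reaching T α) U
      vU = ValidOn-reaching (proj₁ mc) α uk
      valid : ValidOn (reaching T α) (splitOn tj U)
      valid = proj₁ (ValidOn-reaching (proj₁ mc) (α ++ p ∷ ρ) uj) , ValidOn-prune _ _ U vU , ValidOn-prune _ _ U vU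

  -- Forcing along a path

  module _ {T : Tree n} (irr : Irreducible I T) where

    edge-consistent : ∀ β {t₁ y₁ z₁} → subtree T β ≡ just (node t₁ y₁ z₁) →
                      ∀ b₁ γ {t₂ y₂ z₂} → subtree T (β ++ b₁ ∷ γ) ≡ just (node t₂ y₂ z₂) →
                      ∀ b₂ → Consistent I (t₁ , b₁) (t₂ , b₂)
    edge-consistent β u₁ b₁ γ u₂ b₂
      with proj₁ (irr ((β ++ b₁ ∷ γ) ++ b₂ ∷ []) _ (subtree-child T (β ++ b₁ ∷ γ) u₂ b₂))
    ... | q , r = q , reaches-answer T β b₁ γ q u₁ (reaches-prefix T (β ++ b₁ ∷ γ) (b₂ ∷ []) q r)
                    , reaches-answer T (β ++ b₁ ∷ γ) b₂ [] q u₂ r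

    on-path-consistent : ∀ a (ds : List Bool) (k l : Fin (length ds)) → toℕ k ℕ.< toℕ l → ∀ {tk tl} →
                         testAt T (a ++ take (toℕ k) ds) ≡ just tk → testAt T (a ++ take (toℕ l) ds) ≡ just tl →
                         ∀ c → Consistent I (tk , lookup ds k) (tl , c)
    on-path-consistent a ds k l k<l ek el c
      with testAt-node T (a ++ take (toℕ k) ds) ek | testAt-node T (a ++ take (toℕ l) ds) el
         | take>-lookup ds k (toℕ l) k<l
    ... | _ , _ , uk | _ , _ , ul | ρ , take-l =
      edge-consistent (a ++ take (toℕ k) ds) uk (lookup ds k) ρ (subst (λ β → subtree T β ≡ _) below ul) c
      where
      below : a ++ take (toℕ l) ds ≡ (a ++ take (toℕ k) ds) ++ lookup ds k ∷ ρ
      below = trans (cong (a ++_) take-l) (sym (++-assoc a (take (toℕ k) ds) _))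

    module _ (mc : MinimumCost I T) where

      bound-step : ∀ α {tk yk zk} → subtree T α ≡ just (node tk yk zk) →
                   ∀ p {t₁ y₁ z₁} → subtree T (α ++ p ∷ []) ≡ just (node t₁ y₁ z₁) → ∀ p′ γ →
                   weight I T ((α ++ p ∷ []) ++ p′ ∷ γ) ≤ℚ weight I T ((α ++ p ∷ []) ++ not p′ ∷ []) →
                   weight I T (α ++ p ∷ p′ ∷ γ) ≤ℚ weight I T (α ++ not p ∷ [])
      bound-step α {tk} uk p {t₁} u₁ p′ γ ih
        with forcing-dichotomy {tk} {p} {t₁} {p′} (edge-consistent α uk p [] u₁ p′)
                                                  (edge-consistent α uk p [] u₁ (not p′))
      ... | inj₁ F = ℚ.≤-trans
        (subst (λ β → weight I T β ≤ℚ _) (++-assoc α (p ∷ p′ ∷ []) γ)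
               (weight-++-≤ T (α ++ p ∷ p′ ∷ []) γ))
        (exchange-bound mc α uk p u₁ [] u₁ p′ F (λ _ e → e))
      ... | inj₂ F = ℚ.≤-trans
        (subst₂ (λ β β′ → weight I T β ≤ℚ weight I T β′) (∷ʳ-++ α p _) (∷ʳ-++ α p _) ih)
        (exchange-bound mc α uk p u₁ [] u₁ (not p′) F (λ q e → trans e (not-involutive p′)))

      top-forcing-bound : ∀ α {tk yk zk} → subtree T α ≡ just (node tk yk zk) →
                          ∀ p ρ {tj yj zj} → subtree T (α ++ p ∷ ρ) ≡ just (node tj yj zj) →
                          ∀ {pj} → Forces (tj , pj) (tk , p) →
                          weight I T (α ++ p ∷ ρ ++ pj ∷ []) ≤ℚ weight I T (α ++ not p ∷ [])
      top-forcing-bound α uk p [] uj F = exchange-bound mc α uk p uj [] uj _ F (λ _ e → e)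
      top-forcing-bound α uk p (p′ ∷ ρ′) {tj} uj {pj} F with subtree-reassoc T α p (p′ ∷ ρ′) uj
      ... | uj′ with subtree-prefix T (α ++ p ∷ []) p′ ρ′ uj′
      ...   | t₁ , _ , _ , u₁
        with forcing-dichotomy {t₁} {p′} {tj} {pj} (edge-consistent (α ++ p ∷ []) u₁ p′ ρ′ uj′ pj)
                                                   (edge-consistent (α ++ p ∷ []) u₁ p′ ρ′ uj′ (not pj))
      ...     | inj₁ F₁ = bound-step α uk p u₁ p′ (ρ′ ++ pj ∷ [])
                                     (top-forcing-bound (α ++ p ∷ []) u₁ p′ ρ′ uj′ F₁)
      ...     | inj₂ F₂ = exchange-bound mc α uk p u₁ (p′ ∷ ρ′) uj pj F F₂

      forcing-bound : ∀ α p ρ {tj yj zj} → subtree T (α ++ p ∷ ρ) ≡ just (node tj yj zj) →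
                      ∀ ρ₁ {bi ρ₂ ti yi zi} → p ∷ ρ ≡ ρ₁ ++ bi ∷ ρ₂ →
                      subtree T (α ++ ρ₁) ≡ just (node ti yi zi) →
                      ∀ {pj} → Forces (tj , pj) (ti , bi) →
                      weight I T (α ++ p ∷ ρ ++ pj ∷ []) ≤ℚ weight I T (α ++ not p ∷ [])
      forcing-bound α p ρ uj [] refl ui F =
        top-forcing-bound α (subst (λ β → subtree T β ≡ _) (++-identityʳ α) ui) p ρ uj F
      forcing-bound α p [] uj (_ ∷ ρ₁) {bi} {ρ₂} eq ui F
        with ++-conicalʳ ρ₁ (bi ∷ ρ₂) (sym (∷-injectiveʳ eq))
      ... | ()
      forcing-bound α p (p′ ∷ ρ′) uj (_ ∷ ρ₁) eq ui {pj} F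
        with ∷-injectiveˡ eq | subtree-reassoc T α p (p′ ∷ ρ′) uj
      ... | refl | uj′ with subtree-prefix T α p (p′ ∷ ρ′) uj | subtree-prefix T (α ++ p ∷ []) p′ ρ′ uj′
      ...   | _ , _ , _ , uk | _ , _ , _ , u₁ = bound-step α uk p u₁ p′ (ρ′ ++ pj ∷ [])
        (forcing-bound (α ++ p ∷ []) p′ ρ′ uj′ ρ₁ (∷-injectiveʳ eq) (subtree-reassoc T α p ρ₁ ui) F)

      path-bound : ∀ a b bs (i j : Fin (length (b ∷ bs))) → toℕ i ℕ.< toℕ j → ∀ {tᵢ tⱼ} →
                   testAt T (a ++ take (toℕ i) (b ∷ bs)) ≡ just tᵢ →
                   testAt T (a ++ take (toℕ j) (b ∷ bs)) ≡ just tⱼ →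
                   Forces (tⱼ , lookup (b ∷ bs) j) (tᵢ , lookup (b ∷ bs) i) →
                   weight I T (a ++ b ∷ bs) ≤ℚ weight I T (a ++ not b ∷ [])
      path-bound a b bs i (suc j) i<j eᵢ eⱼ F
        with testAt-node T (a ++ take (toℕ i) (b ∷ bs)) eᵢ | testAt-node T (a ++ b ∷ take (toℕ j) bs) eⱼ
           | take>-lookup (b ∷ bs) i (suc (toℕ j)) i<j | take-lookup-++ (b ∷ bs) (suc j)
      ... | _ , _ , uᵢ | _ , _ , uⱼ | _ , take-j | rest , split-ds =
        ℚ.≤-trans (subst (λ β → weight I T β ≤ℚ weight I T child) below (weight-++-≤ T child rest))
                  (forcing-bound a b (take (toℕ j) bs) uⱼ (take (toℕ i) (b ∷ bs)) take-j uᵢ F)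
        where
        child = a ++ b ∷ take (toℕ j) bs ++ lookup bs j ∷ []
        below : child ++ rest ≡ a ++ b ∷ bs
        below = trans (++-assoc a _ rest) (cong (a ++_) (sym split-ds))

theorem3 : (I : Instance) (T : Tree (Instance.n I)) →
    Irreducible I T → MinimumCost I T →
    -- downward path u₁ → ⋯ → u_d: u₁ at address a, then outcomes ds = b ∷ bs (so d = length ds + 1 ≥ 2)
    (a : Address) (b : Bool) (bs : List Bool) →
    (u_d : Tree (Instance.n I)) → subtree T (a ++ b ∷ bs) ≡ just u_d →
    weight I T (a ++ not b ∷ []) <ℚ weight I T (a ++ b ∷ bs) →
    (i j : Fin (length (b ∷ bs))) → i ≢ j →
    ∀ tᵢ tⱼ →
    testAt T (a ++ take (toℕ i) (b ∷ bs)) ≡ just tᵢ →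
    testAt T (a ++ take (toℕ j) (b ∷ bs)) ≡ just tⱼ →
    (c : Bool) → Consistent I (tᵢ , c) (tⱼ , lookup (b ∷ bs) j)
theorem3 I T irr mc a b bs _ _ u₂′<u_d i j i≢j tᵢ tⱼ eᵢ eⱼ c with ℕ.<-cmp (toℕ i) (toℕ j)
... | tri≈ _ i≡j _ = ⊥-elim (i≢j (toℕ-injective i≡j))
... | tri> _ _ j<i =
  consistent-sym I (tⱼ , lookup (b ∷ bs) j) (tᵢ , c) (on-path-consistent I irr a (b ∷ bs) j i j<i eⱼ eᵢ c)
... | tri< i<j _ _ with consistent? I (tᵢ , c) (tⱼ , lookup (b ∷ bs) j) | c ≟ᵇ lookup (b ∷ bs) i
...   | yes consistent | _        = consistent
...   | no _           | yes refl = on-path-consistent I irr a (b ∷ bs) i j i<j eᵢ eⱼ (lookup (b ∷ bs) j)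
...   | no inconsistent | no c≢lᵢ =
  ⊥-elim (ℚ.<-irrefl refl (ℚ.<-≤-trans u₂′<u_d (path-bound I irr mc a b bs i j i<j eᵢ eⱼ forced)))
  where
  forced : Forces (tⱼ , lookup (b ∷ bs) j) (tᵢ , lookup (b ∷ bs) i)
  forced q e = trans (inconsistent⇒forces I tᵢ c tⱼ (lookup (b ∷ bs) j) inconsistent q e)
                     (trans (cong not (¬-not c≢lᵢ)) (not-involutive _))
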